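{- Let $H=(Q^0,Q^1,\delta^0,\delta^1,q_0)$ be a two-player game graph, $Q=Q^0\cup Q^1$, $F_{\mathcal A},F_{\mathcal G}\subseteq Q$, and $Z^\infty$, $\mathrm{rank}$ as defined below. Let $f^1$ be a memoryless system strategy such that for every $q\in Q^1\cap Z^\infty$, $q'=f^1(q)$ satisfies $q'\in\delta^1(q)$, and $q'\in Z^\infty$ with $\mathrm{rank}(q')<\mathrm{rank}(q)$ if $\mathrm{rank}(q)>(1,1)$, and $q'\in Z^\infty$ otherwise. Then for every $q\in Z^\infty$: if $q\in Q^0$ then $\delta^0(q)\subseteq Z^\infty$, and if $q\in Q^1$ then $f^1(q)\in Z^\infty$.
   Context: Game graph: finite disjoint $Q^0$ (environment) and $Q^1$ (system), $\delta^0:Q^0\to2^{Q^1}$, $\delta^1:Q^1\to2^{Q^0}$. For $P,P'\subseteq Q$: $\mathrm{Pre}^{\exists}(P)=\{q\in Q^0:\delta^0(q)\cap P\ne\emptyset\}\cup\{q\in Q^1:\delta^1(q)\cap P\ne\emptyset\}$, $\mathrm{Pre}^1(P)=\{q\in Q^0:\delta^0(q)\subseteq P\}\cup\{q\in Q^1:\delta^1(q)\cap P\ne\emptyset\}$, $\mathrm{CPre}(P,P')=\mathrm{Pre}^{\exists}(P)\cap\mathrm{Pre}^1(P\cup P')$. $Z^\infty$ is the value of $\nu Z.\mu Y.\nu X.\mu W.(F_{\mathcal G}\cap\mathrm{Pre}^1(Z))\cup\mathrm{Pre}^1(Y)\cup((Q\setminus F_{\mathcal A})\cap\mathrm{CPre}(W,X\setminus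 F_{\mathcal A}))$. With $\Phi(Y,X,W)=(F_{\mathcal G}\cap\mathrm{Pre}^1(Z^\infty))\cup\mathrm{Pre}^1(Y)\cup((Q\setminus F_{\mathcal A})\cap\mathrm{CPre}(W,X\setminus F_{\mathcal A}))$: $Y^0=\emptyset$, $Y^i=\nu X.\mu W.\Phi(Y^{i-1},X,W)$; $W^i_0=\emptyset$, $W^i_j=\Phi(Y^{i-1},Y^i,W^i_{j-1})$. For $q\in Z^\infty$, $\mathrm{rank}(q)=(i,j)$ ($i,j>0$) iff $q\in(Y^i\setminus Y^{i-1})\cap(W^i_j\setminus W^i_{j-1})$; ranks are ordered lexicographically. -}

module Defs where

open import Data.Nat using (ℕ; zero; suc; _<_)
open import Data.Bool using (Bool; true; false; _∧_; _∨_; not; if_then_else_)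
open import Data.Fin using (Fin)
open import Data.Vec using (Vec; []; _∷_; tabulate; lookup)
open import Data.Fin.Subset using (Subset; ⊥; ⊤; _∩_; _∪_; ∁; _─_; _∈_; _∉_; _⊆_)
open import Data.Product using (_×_; _,_)
open import Data.Sum using (_⊎_)
open import Relation.Binary.PropositionalEquality using (_≡_)
open import Data.Empty renaming (⊥ to Empty)

_<lex_ : ℕ × ℕ → ℕ × ℕ → Set
(i , j) <lex (i' , j') = i < i' ⊎ (i ≡ i' × j < j')


anyIn : ∀ {n} → Subset n → Bool
anyIn []       = false
anyIn (b ∷ bs) = b ∨ anyIn bs

allIn : ∀ {n} → Subset n → Bool
allIn []       = true
allIn (b ∷ bs) = b ∧ allIn bs

-- Q¹ (system states) is the subset 'sys'; Q⁰ (environment states) is its complement,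
-- so Q⁰ and Q¹ are disjoint and cover Q.  'δ q' is δ⁰(q) for q ∈ Q⁰ and δ¹(q) for q ∈ Q¹.
record GameGraph (n : ℕ) : Set where
  field
    sys  : Subset n
    δ    : Fin n → Subset n
    q₀   : Fin n
    δ⁰-into-Q¹ : ∀ q q' → q ∉ sys → q' ∈ δ q → q' ∈ sys
    δ¹-into-Q⁰ : ∀ q q' → q ∈ sys → q' ∈ δ q → q' ∉ sys

-- Least / greatest fixpoints of operators on the finite lattice Subset n,
-- computed by Kleene iteration from ⊥ / ⊤ (n+1 steps; all operators used below are
-- monotone, and every chain in Subset n has length ≤ n, so these are the exact fixpoints).
iter : ∀ {A : Set} → ℕ → (A → A) → A → A
iter zero    f a = a
iter (suc k) f a = f (iter k f a)

μ : ∀ {n} → (Subset n → Subset n) → Subset n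
μ {n} f = iter (suc n) f ⊥

ν : ∀ {n} → (Subset n → Subset n) → Subset n
ν {n} f = iter (suc n) f ⊤

module Game {n : ℕ} (H : GameGraph n) (F𝒜 F𝒢 : Subset n) where
  open GameGraph H

  Q : Subset n
  Q = ⊤

  Pre∃ : Subset n → Subset n
  Pre∃ P = tabulate λ q → anyIn (δ q ∩ P)

  Pre¹ : Subset n → Subset n
  Pre¹ P = tabulate λ q →
    if lookup sys q then anyIn (δ q ∩ P) else allIn (∁ (δ q) ∪ P)

  CPre : Subset n → Subset n → Subset n
  CPre P P' = Pre∃ P ∩ Pre¹ (P ∪ P')

  body : Subset n → Subset n → Subset n → Subset n → Subset n
  body Z Y X W = (F𝒢 ∩ Pre¹ Z) ∪ Pre¹ Y ∪ ((Q ─ F𝒜) ∩ CPre W (X ─ F𝒜))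

  Z∞ : Subset n
  Z∞ = ν λ Z → μ λ Y → ν λ X → μ λ W → body Z Y X W

  Φ : Subset n → Subset n → Subset n → Subset n
  Φ Y X W = body Z∞ Y X W

  Yᵢ : ℕ → Subset n
  Yᵢ zero    = ⊥
  Yᵢ (suc i) = ν λ X → μ λ W → Φ (Yᵢ i) X W

  -- W^i_j (only meaningful for i > 0; W^0_j is set to ∅ and never used)
  Wᵢⱼ : ℕ → ℕ → Subset n
  Wᵢⱼ zero    j       = ⊥
  Wᵢⱼ (suc i) zero    = ⊥
  Wᵢⱼ (suc i) (suc j) = Φ (Yᵢ i) (Yᵢ (suc i)) (Wᵢⱼ (suc i) j)

  HasRank : Fin n → ℕ → ℕ → Set
  HasRank q zero    _       = Empty
  HasRank q (suc i) zero    = Empty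
  HasRank q (suc i) (suc j) =
    q ∈ Z∞ × q ∈ Yᵢ (suc i) × q ∉ Yᵢ i × q ∈ Wᵢⱼ (suc i) (suc j) × q ∉ Wᵢⱼ (suc i) j

-- Z∞ is a fixed point of Z ↦ body Z Z Z Z: Kleene iteration of a monotone operator on the finite
-- lattice Subset n stabilises within n steps, so every μ and ν in the nested definition returns a
-- fixed point, and the nested fixed points then coincide. At an environment state each disjunct of
-- body Z Z Z Z has the form Pre¹ P with P ⊆ Z, so all successors stay in Z∞. At a system state the
-- hypothesis already gives f¹ q ∈ Z∞.
module Submission where

open import Defs
open import Data.Nat using (ℕ; zero; suc; _≤_; _<_; _≤′_; ≤′-refl; ≤′-step; z≤n; s≤s)
open import Data.Nat.Properties
  using (≤-trans; ≤⇒≤′; n<1+n; m<n⇒m<1+n; m≤n⇒m≤1+n; 1+n≰n)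
open import Data.Bool using (Bool; true; false; if_then_else_)
import Data.Bool.Properties as Bool
open import Data.Fin using (Fin; zero; suc)
open import Data.Fin.Subset
  using (Subset; Nonempty; ⊤; ⊥; _∩_; _∪_; ∁; _─_; _∈_; _∉_; _⊆_; _⊂_; ∣_∣)
open import Data.Fin.Subset.Properties
  using (_∈?_; _⊂?_; ⊆-refl; ⊆-antisym; ⊆⊤; ⊥⊆; ∣p∣≤n; p⊂q⇒∣p∣<∣q∣; p⊂q⇒∁p⊃∁q;
         x∈p∩q⁺; x∈p∩q⁻; x∈p∪q⁺; x∈p∪q⁻; x∈p∧x∉q⇒x∈p─q; p─q⊆p; x∈∁p⇒x∉p; drop-there)
open import Data.Vec using ([]; _∷_; tabulate; lookup; here; there)
open import Data.Vec.Properties using (lookup∘tabulate; []=⇒lookup; lookup⇒[]=; ≡-dec)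
open import Data.Product using (_×_; _,_; ∃; ∃₂; proj₁; proj₂)
open import Data.Sum using (_⊎_; inj₁; inj₂; [_,_]′)
open import Data.Empty using (⊥-elim)
open import Function using (_∘_)
open import Relation.Binary.Core using (_Preserves_⟶_)
open import Relation.Binary.Definitions using (DecidableEquality)
open import Relation.Binary.PropositionalEquality using (_≡_; _≢_; refl; sym; trans; cong; subst)
open import Relation.Nullary using (yes; no)
open import Relation.Nullary.Decidable using (decidable-stable)

private
  variable
    n : ℕ

stabilises-below : ∀ {A : Set} → DecidableEquality A → (s : ℕ → A) (m : A → ℕ) (N : ℕ) →
  (∀ x → m x ≤ N) → (∀ k → s (suc k) ≢ s k → m (s k) < m (s (suc k))) →
  ∃ λ k → k ≤ N × s (suc k) ≡ s k
stabilises-below _≟_ s m N bounded grows with stationary-or-large (suc N)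
  where
  stationary-or-large : ∀ k → (∃ λ j → j < k × s (suc j) ≡ s j) ⊎ k ≤ m (s k)
  stationary-or-large zero = inj₂ z≤n
  stationary-or-large (suc k) with stationary-or-large k | s (suc k) ≟ s k
  ... | inj₁ (j , j<k , e) | _         = inj₁ (j , m<n⇒m<1+n j<k , e)
  ... | inj₂ _             | yes e     = inj₁ (k , n<1+n k , e)
  ... | inj₂ k≤m           | no moved = inj₂ (≤-trans (s≤s k≤m) (grows k moved))
... | inj₁ (k , s≤s k≤N , e) = k , k≤N , e
... | inj₂ large = ⊥-elim (1+n≰n (≤-trans large (bounded (s (suc N)))))

iter-stationary : ∀ {A : Set} {f : A → A} {a : A} {k m : ℕ} →
  f (iter k f a) ≡ iter k f a → k ≤′ m → iter m f a ≡ iter k f a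
iter-stationary e ≤′-refl = refl
iter-stationary {f = f} e (≤′-step k≤′m) = trans (cong f (iter-stationary e k≤′m)) e

iter-fixedPoint : ∀ {A : Set} {f : A → A} {a : A} {k m : ℕ} →
  k ≤ m → f (iter k f a) ≡ iter k f a → f (iter m f a) ≡ iter m f a
iter-fixedPoint k≤m e =
  trans (iter-stationary e (≤′-step (≤⇒≤′ k≤m))) (sym (iter-stationary e (≤⇒≤′ k≤m)))

iter-fixedPoint-by-measure : ∀ {A : Set} → DecidableEquality A → {f : A → A} {a : A}
  (m : A → ℕ) (N : ℕ) → (∀ x → m x ≤ N) →
  (∀ k → iter (suc k) f a ≢ iter k f a → m (iter k f a) < m (iter (suc k) f a)) →
  f (iter (suc N) f a) ≡ iter (suc N) f a
iter-fixedPoint-by-measure _≟_ {f} {a} m N bounded grows =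
  let k , k≤N , e = stabilises-below _≟_ (λ k → iter k f a) m N bounded grows
  in iter-fixedPoint (m≤n⇒m≤1+n k≤N) e

iter-mono : ∀ {f g : Subset n → Subset n} → f Preserves _⊆_ ⟶ _⊆_ → (∀ p → f p ⊆ g p) →
  ∀ k {a b} → a ⊆ b → iter k f a ⊆ iter k g b
iter-mono f-mono f⊆g zero    a⊆b = a⊆b
iter-mono f-mono f⊆g (suc k) a⊆b = f⊆g _ ∘ f-mono (iter-mono f-mono f⊆g k a⊆b)

⊆∧≢⇒⊂ : ∀ {p q : Subset n} → p ⊆ q → p ≢ q → p ⊂ q
⊆∧≢⇒⊂ {p = p} {q} p⊆q p≢q with p ⊂? q
... | yes p⊂q = p⊂q
... | no  p⊄q = ⊥-elim (p≢q (⊆-antisym p⊆q q⊆p))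
  where
  q⊆p : q ⊆ p
  q⊆p {x} x∈q = decidable-stable (x ∈? p) (λ x∉p → p⊄q (p⊆q , x , x∈q , x∉p))

μ-fixedPoint : ∀ {f : Subset n → Subset n} → f Preserves _⊆_ ⟶ _⊆_ → f (μ f) ≡ μ f
μ-fixedPoint {n} {f} f-mono = iter-fixedPoint-by-measure (≡-dec Bool._≟_) ∣_∣ n ∣p∣≤n grows
  where
  increasing : ∀ k → iter k f ⊥ ⊆ iter (suc k) f ⊥
  increasing zero    = ⊥⊆
  increasing (suc k) = f-mono (increasing k)
  grows : ∀ k → iter (suc k) f ⊥ ≢ iter k f ⊥ → ∣ iter k f ⊥ ∣ < ∣ iter (suc k) f ⊥ ∣
  grows k moved = p⊂q⇒∣p∣<∣q∣ (⊆∧≢⇒⊂ (increasing k) (moved ∘ sym))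

ν-fixedPoint : ∀ {f : Subset n → Subset n} → f Preserves _⊆_ ⟶ _⊆_ → f (ν f) ≡ ν f
ν-fixedPoint {n} {f} f-mono =
  iter-fixedPoint-by-measure (≡-dec Bool._≟_) (∣_∣ ∘ ∁) n (∣p∣≤n ∘ ∁) grows
  where
  decreasing : ∀ k → iter (suc k) f ⊤ ⊆ iter k f ⊤
  decreasing zero    = ⊆⊤
  decreasing (suc k) = f-mono (decreasing k)
  grows : ∀ k → iter (suc k) f ⊤ ≢ iter k f ⊤ → ∣ ∁ (iter k f ⊤) ∣ < ∣ ∁ (iter (suc k) f ⊤) ∣
  grows k moved = p⊂q⇒∣p∣<∣q∣ (p⊂q⇒∁p⊃∁q (⊆∧≢⇒⊂ (decreasing k) moved))

μ-mono : ∀ {f g : Subset n → Subset n} → f Preserves _⊆_ ⟶ _⊆_ → (∀ p → f p ⊆ g p) → μ f ⊆ μ g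
μ-mono {n} f-mono f⊆g = iter-mono f-mono f⊆g (suc n) ⊆-refl

ν-mono : ∀ {f g : Subset n → Subset n} → f Preserves _⊆_ ⟶ _⊆_ → (∀ p → f p ⊆ g p) → ν f ⊆ ν g
ν-mono {n} f-mono f⊆g = iter-mono f-mono f⊆g (suc n) ⊆-refl

module _ (B : Subset n → Subset n → Subset n → Subset n → Subset n)
         (B-mono : ∀ {Z Z′ Y Y′ X X′ W W′} → Z ⊆ Z′ → Y ⊆ Y′ → X ⊆ X′ → W ⊆ W′ →
                   B Z Y X W ⊆ B Z′ Y′ X′ W′) where

  private
    Wfix : Subset n → Subset n → Subset n → Subset n
    Wfix Z Y X = μ (B Z Y X)

    Xfix : Subset n → Subset n → Subset n
    Xfix Z Y = ν (Wfix Z Y)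

    Yfix : Subset n → Subset n
    Yfix Z = μ (Xfix Z)

    Wfix-mono : ∀ {Z Z′ Y Y′ X X′} → Z ⊆ Z′ → Y ⊆ Y′ → X ⊆ X′ → Wfix Z Y X ⊆ Wfix Z′ Y′ X′
    Wfix-mono Z⊆ Y⊆ X⊆ = μ-mono (B-mono ⊆-refl ⊆-refl ⊆-refl) (λ _ → B-mono Z⊆ Y⊆ X⊆ ⊆-refl)

    Xfix-mono : ∀ {Z Z′ Y Y′} → Z ⊆ Z′ → Y ⊆ Y′ → Xfix Z Y ⊆ Xfix Z′ Y′
    Xfix-mono Z⊆ Y⊆ = ν-mono (Wfix-mono ⊆-refl ⊆-refl) (λ _ → Wfix-mono Z⊆ Y⊆ ⊆-refl)

    Yfix-mono : ∀ {Z Z′} → Z ⊆ Z′ → Yfix Z ⊆ Yfix Z′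
    Yfix-mono Z⊆ = μ-mono (Xfix-mono ⊆-refl) (λ _ → Xfix-mono Z⊆ ⊆-refl)

  νμνμ-diagonal-fixedPoint :
    let Z∞ = ν λ Z → μ λ Y → ν λ X → μ λ W → B Z Y X W in B Z∞ Z∞ Z∞ Z∞ ≡ Z∞
  νμνμ-diagonal-fixedPoint =
    collapse Y∞≡Z∞ (trans X∞≡Y∞ Y∞≡Z∞) (trans W∞≡X∞ (trans X∞≡Y∞ Y∞≡Z∞)) B∞≡W∞
    where
    Z∞ Y∞ X∞ W∞ : Subset n
    Z∞ = ν Yfix
    Y∞ = Yfix Z∞
    X∞ = Xfix Z∞ Y∞
    W∞ = Wfix Z∞ Y∞ X∞

    Y∞≡Z∞ : Y∞ ≡ Z∞
    Y∞≡Z∞ = ν-fixedPoint Yfix-mono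
    X∞≡Y∞ : X∞ ≡ Y∞
    X∞≡Y∞ = μ-fixedPoint (Xfix-mono ⊆-refl)
    W∞≡X∞ : W∞ ≡ X∞
    W∞≡X∞ = ν-fixedPoint (Wfix-mono ⊆-refl ⊆-refl)
    B∞≡W∞ : B Z∞ Y∞ X∞ W∞ ≡ W∞
    B∞≡W∞ = μ-fixedPoint (B-mono ⊆-refl ⊆-refl ⊆-refl)

    collapse : ∀ {Y X W} → Y ≡ Z∞ → X ≡ Z∞ → W ≡ Z∞ → B Z∞ Y X W ≡ W → B Z∞ Z∞ Z∞ Z∞ ≡ Z∞
    collapse refl refl refl e = e

∈-tabulate⁻ : ∀ (g : Fin n → Bool) {x} → x ∈ tabulate g → g x ≡ true
∈-tabulate⁻ g {x} x∈ = trans (sym (lookup∘tabulate g x)) ([]=⇒lookup x∈)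

∈-tabulate⁺ : ∀ (g : Fin n → Bool) {x} → g x ≡ true → x ∈ tabulate g
∈-tabulate⁺ g {x} gx = lookup⇒[]= x (tabulate g) (trans (lookup∘tabulate g x) gx)

tabulate-mono : ∀ {g h : Fin n → Bool} → (∀ x → g x ≡ true → h x ≡ true) → tabulate g ⊆ tabulate h
tabulate-mono {g = g} {h} g⇒h {x} x∈ = ∈-tabulate⁺ h (g⇒h x (∈-tabulate⁻ g x∈))

anyIn⇒Nonempty : ∀ (p : Subset n) → anyIn p ≡ true → Nonempty p
anyIn⇒Nonempty (true  ∷ p) _ = zero , here
anyIn⇒Nonempty (false ∷ p) any with anyIn⇒Nonempty p any
... | x , x∈p = suc x , there x∈p

∈⇒anyIn : ∀ {p : Subset n} {x} → x ∈ p → anyIn p ≡ true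
∈⇒anyIn here = refl
∈⇒anyIn {p = b ∷ _} (there x∈p) rewrite ∈⇒anyIn x∈p = Bool.∨-zeroʳ b

allIn⇒∈ : ∀ (p : Subset n) → allIn p ≡ true → ∀ x → x ∈ p
allIn⇒∈ (true ∷ p) all zero    = here
allIn⇒∈ (true ∷ p) all (suc x) = there (allIn⇒∈ p all x)

∈⇒allIn : ∀ (p : Subset n) → (∀ x → x ∈ p) → allIn p ≡ true
∈⇒allIn []      _   = refl
∈⇒allIn (b ∷ p) ∈p with ∈p zero
... | here = ∈⇒allIn p (λ x → drop-there (∈p (suc x)))

anyIn-mono : ∀ {p q : Subset n} → p ⊆ q → anyIn p ≡ true → anyIn q ≡ true
anyIn-mono {p = p} p⊆q any = ∈⇒anyIn (p⊆q (proj₂ (anyIn⇒Nonempty p any)))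

allIn-mono : ∀ {p q : Subset n} → p ⊆ q → allIn p ≡ true → allIn q ≡ true
allIn-mono {p = p} {q} p⊆q all = ∈⇒allIn q (λ x → p⊆q (allIn⇒∈ p all x))

∩-mono : ∀ {p p′ q q′ : Subset n} → p ⊆ p′ → q ⊆ q′ → p ∩ q ⊆ p′ ∩ q′
∩-mono {p = p} {q = q} p⊆ q⊆ x∈ with x∈p∩q⁻ p q x∈
... | x∈p , x∈q = x∈p∩q⁺ (p⊆ x∈p , q⊆ x∈q)

∪-mono : ∀ {p p′ q q′ : Subset n} → p ⊆ p′ → q ⊆ q′ → p ∪ q ⊆ p′ ∪ q′
∪-mono {p = p} {q = q} p⊆ q⊆ x∈ with x∈p∪q⁻ p q x∈
... | inj₁ x∈p = x∈p∪q⁺ (inj₁ (p⊆ x∈p))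
... | inj₂ x∈q = x∈p∪q⁺ (inj₂ (q⊆ x∈q))

x∈p─q⇒x∉q : ∀ (p q : Subset n) {x} → x ∈ p ─ q → x ∉ q
x∈p─q⇒x∉q (_ ∷ p) (_ ∷ q) (there x∈) (there x∈q) = x∈p─q⇒x∉q p q x∈ x∈q

─-monoˡ : ∀ {p p′ : Subset n} (q : Subset n) → p ⊆ p′ → p ─ q ⊆ p′ ─ q
─-monoˡ {p = p} q p⊆ x∈ = x∈p∧x∉q⇒x∈p─q (p⊆ (p─q⊆p p q x∈)) (x∈p─q⇒x∉q p q x∈)

module _ (H : GameGraph n) (F𝒜 F𝒢 : Subset n) where
  open GameGraph H
  open Game H F𝒜 F𝒢

  Pre∃-mono : Pre∃ Preserves _⊆_ ⟶ _⊆_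
  Pre∃-mono P⊆ = tabulate-mono (λ q → anyIn-mono (∩-mono (⊆-refl {x = δ q}) P⊆))

  Pre¹-mono : Pre¹ Preserves _⊆_ ⟶ _⊆_
  Pre¹-mono {P} {P′} P⊆ = tabulate-mono controllable-mono
    where
    controllable-mono : ∀ q →
      (if lookup sys q then anyIn (δ q ∩ P) else allIn (∁ (δ q) ∪ P)) ≡ true →
      (if lookup sys q then anyIn (δ q ∩ P′) else allIn (∁ (δ q) ∪ P′)) ≡ true
    controllable-mono q with lookup sys q
    ... | true  = anyIn-mono (∩-mono (⊆-refl {x = δ q}) P⊆)
    ... | false = allIn-mono (∪-mono (⊆-refl {x = ∁ (δ q)}) P⊆)

  body-mono : ∀ {Z Z′ Y Y′ X X′ W W′} → Z ⊆ Z′ → Y ⊆ Y′ → X ⊆ X′ → W ⊆ W′ →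
              body Z Y X W ⊆ body Z′ Y′ X′ W′
  body-mono Z⊆ Y⊆ X⊆ W⊆ =
    ∪-mono (∩-mono ⊆-refl (Pre¹-mono Z⊆))
      (∪-mono (Pre¹-mono Y⊆)
        (∩-mono ⊆-refl (∩-mono (Pre∃-mono W⊆) (Pre¹-mono (∪-mono W⊆ (─-monoˡ F𝒜 X⊆))))))

  Pre¹-env : ∀ {P q} → q ∉ sys → q ∈ Pre¹ P → δ q ⊆ P
  Pre¹-env {P} {q} q∉sys q∈ {x} x∈δq with lookup sys q in eq | ∈-tabulate⁻ _ q∈
  ... | true  | _   = ⊥-elim (q∉sys (lookup⇒[]= q sys eq))
  ... | false | all with x∈p∪q⁻ (∁ (δ q)) P (allIn⇒∈ _ all x)
  ...   | inj₁ x∈∁δq = ⊥-elim (x∈∁p⇒x∉p x∈∁δq x∈δq)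
  ...   | inj₂ x∈P   = x∈P

  body-diagonal-env : ∀ {Z q} → q ∉ sys → q ∈ body Z Z Z Z → δ q ⊆ Z
  body-diagonal-env {Z} {q} q∉sys q∈ x∈δq with x∈p∪q⁻ _ _ q∈
  ... | inj₁ q∈F𝒢∩Pre¹ = Pre¹-env q∉sys (proj₂ (x∈p∩q⁻ F𝒢 _ q∈F𝒢∩Pre¹)) x∈δq
  ... | inj₂ q∈ with x∈p∪q⁻ _ _ q∈
  ...   | inj₁ q∈Pre¹ = Pre¹-env q∉sys q∈Pre¹ x∈δq
  ...   | inj₂ q∈CPre with x∈p∪q⁻ Z (Z ─ F𝒜) (Pre¹-env q∉sys q∈Pre¹[Z∪Z─F𝒜] x∈δq)
    where
    q∈Pre¹[Z∪Z─F𝒜] : q ∈ Pre¹ (Z ∪ (Z ─ F𝒜))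
    q∈Pre¹[Z∪Z─F𝒜] = proj₂ (x∈p∩q⁻ (Pre∃ Z) _ (proj₂ (x∈p∩q⁻ (Q ─ F𝒜) _ q∈CPre)))
  ...     | inj₁ x∈Z    = x∈Z
  ...     | inj₂ x∈Z─F𝒜 = p─q⊆p Z F𝒜 x∈Z─F𝒜

  Z∞-fixedPoint : body Z∞ Z∞ Z∞ Z∞ ≡ Z∞
  Z∞-fixedPoint = νμνμ-diagonal-fixedPoint body body-mono

lemma2 : ∀ {n} (H : GameGraph n) (F𝒜 F𝒢 : Subset n) (f¹ : Fin n → Fin n) →
    let open GameGraph H
        open Game H F𝒜 F𝒢
    in (∀ q → q ∈ sys → q ∈ Z∞ →
          f¹ q ∈ δ q × f¹ q ∈ Z∞ ×
          (∀ i j → HasRank q i j → (1 , 1) <lex (i , j) →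
             ∃₂ λ i' j' → HasRank (f¹ q) i' j' × (i' , j') <lex (i , j))) →
       ∀ q → q ∈ Z∞ →
         (q ∉ sys → δ q ⊆ Z∞) × (q ∈ sys → f¹ q ∈ Z∞)
lemma2 H F𝒜 F𝒢 f¹ strategy q q∈Z∞ =
    (λ q∉sys → body-diagonal-env H F𝒜 F𝒢 q∉sys (subst (q ∈_) (sym (Z∞-fixedPoint H F𝒜 F𝒢)) q∈Z∞))
  , (λ q∈sys → proj₁ (proj₂ (strategy q q∈sys q∈Z∞)))
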